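{- Let $m$ be a positive integer, let $k,d$ be positive integers, and let $A=(a_0,\dots,a_{k-1})$, $D=(d_0,\dots,d_{k-1})$ be $k$-tuples of elements of $\mathbb{Z}/m\mathbb{Z}$ such that the sequence $S=\mathrm{IAP}(A,D)$ is $dk$-periodic. Then the first period $S[dk]=(u_0,\dots,u_{dk-1})$ is antisymmetric if and only if $D=AX_k$.
   Context: $\mathrm{IAP}(A,D)$ is the doubly infinite sequence $(u_j)_{j\in\mathbb{Z}}$ with $u_{qk+r}=a_r+qd_r$ ($q\in\mathbb{Z}$, $0\le r\le k-1$). A sequence is $p$-periodic if $u_{j+p}=u_j$ for all $j$. A finite sequence $(v_0,\dots,v_{N-1})$ is antisymmetric if $v_{N-1-j}=-v_j$ for all $j$. $X_k$ is the $k\times k$ integer matrix with entries $\delta_{r,s}+\delta_{r,k-s+1}$ ($r,s\in\{1,\dots,k\}$), tuples are row vectors and $AX_k$ is computed in $\mathbb{Z}/m\mathbb{Z}$. -}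

module Defs where

open import Data.Nat.Base as ℕ using (ℕ; NonZero)
open import Data.Integer.Base using (ℤ; +_; _+_; _*_; -_; _-_; _/ℕ_; _%ℕ_)
open import Data.Integer.DivMod using (n%ℕd<d)
open import Data.Integer.Divisibility using (_∣_)
open import Data.Fin.Base using (Fin; zero; suc; fromℕ<; opposite)
open import Data.Fin.Properties using (_≟_)
open import Relation.Nullary.Decidable using (⌊_⌋)
open import Data.Bool.Base using (if_then_else_)

-- Elements of ℤ/mℤ are represented by integer representatives;
-- equality in ℤ/mℤ is congruence modulo m.
_≡[mod_]_ : ℤ → ℕ → ℤ → Set
x ≡[mod m ] y = (+ m) ∣ (x - y)

-- IAP(A,D) as a doubly infinite sequence ℤ → ℤ:
-- u_j = a_r + q d_r where j = q k + r, 0 ≤ r < k (Euclidean division).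
IAP : (k : ℕ) .{{_ : NonZero k}} → (Fin k → ℤ) → (Fin k → ℤ) → ℤ → ℤ
IAP k A D j = A r + q * D r
  where
  q : ℤ
  q = j /ℕ k
  r : Fin k
  r = fromℕ< (n%ℕd<d j k)

Periodic : ℕ → ℕ → (ℤ → ℤ) → Set
Periodic m p u = ∀ (j : ℤ) → u (j + + p) ≡[mod m ] u j

Antisymmetric : ℕ → (N : ℕ) → (Fin N → ℤ) → Set
Antisymmetric m N v = ∀ (j : Fin N) → v (opposite j) ≡[mod m ] (- v j)

firstPeriod : (p : ℕ) → (ℤ → ℤ) → Fin p → ℤ
firstPeriod p u j = u (+ (Data.Fin.Base.toℕ j))

δ : ∀ {k} → Fin k → Fin k → ℤ
δ r s = if ⌊ r ≟ s ⌋ then + 1 else + 0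

-- X_k with entries δ_{r,s} + δ_{r,k-s+1} (1-indexed); in 0-indexed form
-- the index k-s+1 becomes k-1-s = opposite s.
X : (k : ℕ) → Fin k → Fin k → ℤ
X k r s = δ r s + δ r (opposite s)

sumFin : (k : ℕ) → (Fin k → ℤ) → ℤ
sumFin ℕ.zero    f = + 0
sumFin (ℕ.suc k) f = f zero + sumFin k (λ i → f (suc i))

_·ᵥₘ_ : ∀ {k} → (Fin k → ℤ) → (Fin k → Fin k → ℤ) → Fin k → ℤ
_·ᵥₘ_ {k} A M s = sumFin k (λ r → A r * M r s)

_≋[mod_]_ : ∀ {k} → (Fin k → ℤ) → ℕ → (Fin k → ℤ) → Set
_≋[mod_]_ {k} U m V = ∀ (s : Fin k) → U s ≡[mod m ] V s

{-# OPTIONS --safe #-}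
-- Write an index of the first period as j = qk + r with q < d and r < k, so
-- u_j = a_r + q d_r; since dk − 1 − j = (d − 1 − q)k + (k − 1 − r), also
-- u_{dk−1−j} = a_r′ + (d − 1 − q) d_r′ with r′ = k − 1 − r.  Periodicity gives
-- d d_r = 0.  Antisymmetry at q = d − 1 reads a_r′ = −a_r − (d − 1) d_r = d_r − a_r,
-- i.e. d_r = a_r + a_r′ = (AX_k)_r.  Conversely, if D = AX_k then d_r′ = d_r, and
-- u_j + u_{dk−1−j} = (a_r + a_r′) + (d − 1) d_r = d d_r = 0.
module Submission where

open import Defs
open import Data.Nat.Base using (ℕ; NonZero; _*_)
open import Data.Integer.Base using (ℤ)
open import Data.Fin.Base using (Fin)
open import Function.Bundles using (_⇔_)

open import Level using (0ℓ)
import Data.Nat.Base as ℕ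
open import Data.Nat.Base using (suc)
import Data.Nat.Properties as ℕ
import Data.Nat.DivMod as ℕ
import Data.Nat.Divisibility as ℕ
import Data.Nat.Tactic.RingSolver as ℕ-Solver
open import Data.Integer.Base using (+_; -_; _+_; _-_; 0ℤ)
import Data.Integer.Base as ℤ
import Data.Integer.Properties as ℤ
import Data.Integer.Divisibility.Signed as ℤ
open import Data.Integer.Tactic.RingSolver using (solve-∀)
open import Algebra.Properties.CommutativeSemigroup ℤ.+-commutativeSemigroup using (interchange)
open import Data.Fin.Base using (zero; suc; toℕ; fromℕ<; opposite; combine)
import Data.Fin.Properties as Fin
open import Data.Product using (_,_)
open import Function.Bundles using (mk⇔)
open import Relation.Binary.Bundles using (Setoid)
open import Relation.Binary.PropositionalEquality
  using (_≡_; refl; sym; trans; cong; cong₂; module ≡-Reasoning)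
open import Relation.Nullary using (yes; no)

module Congruence (m : ℕ) where

  -- A record wrapper around x ≡[mod m ] y: that definition unfolds to a
  -- divisibility of ∣ x - y ∣, from which Agda cannot infer x and y.
  infix 4 _≈_
  record _≈_ (x y : ℤ) : Set where
    constructor mod
    field m∣x-y : + m ℤ.∣ x - y

  ≡[mod]⇒≈ : ∀ {x y} → x ≡[mod m ] y → x ≈ y
  ≡[mod]⇒≈ p = mod (ℤ.∣ᵤ⇒∣ p)

  ≈⇒≡[mod] : ∀ {x y} → x ≈ y → x ≡[mod m ] y
  ≈⇒≡[mod] (mod p) = ℤ.∣⇒∣ᵤ p

  private
    by : ∀ {x y e} → + m ℤ.∣ e → e ≡ x - y → x ≈ y
    by m∣e refl = mod m∣e

  ≈-reflexive : ∀ {x y} → x ≡ y → x ≈ y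
  ≈-reflexive {x} refl = by (ℤ.divides 0ℤ refl) (sym (ℤ.+-inverseʳ x))

  ≈-refl : ∀ {x} → x ≈ x
  ≈-refl = ≈-reflexive refl

  ≈-sym : ∀ {x y} → x ≈ y → y ≈ x
  ≈-sym {x} {y} (mod p) = by (ℤ.∣m⇒∣-m p) (identity x y)
    where
    identity : ∀ x y → - (x - y) ≡ y - x
    identity = solve-∀

  ≈-trans : ∀ {x y z} → x ≈ y → y ≈ z → x ≈ z
  ≈-trans {x} {y} {z} (mod p) (mod q) = by (ℤ.∣m∣n⇒∣m+n p q) (ℤ.+-minus-telescope x y z)

  setoid : Setoid 0ℓ 0ℓ
  setoid = record
    { _≈_           = _≈_
    ; isEquivalence = record { refl = ≈-refl ; sym = ≈-sym ; trans = ≈-trans }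
    }

  +-cong : ∀ {x y u v} → x ≈ y → u ≈ v → x + u ≈ y + v
  +-cong {x} {y} {u} {v} (mod p) (mod q) = by (ℤ.∣m∣n⇒∣m+n p q) (identity x y u v)
    where
    identity : ∀ x y u v → (x - y) + (u - v) ≡ (x + u) - (y + v)
    identity = solve-∀

  +-congˡ : ∀ x {u v} → u ≈ v → x + u ≈ x + v
  +-congˡ x = +-cong (≈-refl {x})

  +-congʳ : ∀ u {x y} → x ≈ y → x + u ≈ y + u
  +-congʳ u p = +-cong p (≈-refl {u})

  *-congˡ : ∀ z {x y} → x ≈ y → z ℤ.* x ≈ z ℤ.* y
  *-congˡ z {x} {y} (mod p) = by (ℤ.∣n⇒∣m*n z p) (identity z x y)
    where
    identity : ∀ z x y → z ℤ.* (x - y) ≡ z ℤ.* x - z ℤ.* y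
    identity = solve-∀

  +-cancelˡ : ∀ x {y z} → x + y ≈ x + z → y ≈ z
  +-cancelˡ x {y} {z} (mod p) = by p (identity x y z)
    where
    identity : ∀ x y z → (x + y) - (x + z) ≡ y - z
    identity = solve-∀

  x+y≈0⇒x≈-y : ∀ x y → x + y ≈ 0ℤ → x ≈ - y
  x+y≈0⇒x≈-y x y (mod p) = by p (identity x y)
    where
    identity : ∀ x y → (x + y) - 0ℤ ≡ x - - y
    identity = solve-∀

toℕ-opposite-+-suc : ∀ {n} (i : Fin n) → toℕ (opposite i) ℕ.+ suc (toℕ i) ≡ n
toℕ-opposite-+-suc i =
  trans (cong (ℕ._+ suc (toℕ i)) (Fin.opposite-prop i)) (ℕ.m∸n+n≡m (Fin.toℕ<n i))

opposite-combine : ∀ {d k} (i : Fin d) (j : Fin k) →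
                   opposite (combine i j) ≡ combine (opposite i) (opposite j)
opposite-combine {d} {k} i j = Fin.toℕ-injective (ℕ.+-cancelʳ-≡ (suc (toℕ (combine i j))) _ _
  (trans (toℕ-opposite-+-suc (combine i j)) (sym sum≡d*k)))
  where
  open ≡-Reasoning
  a b c e : ℕ
  a = toℕ (opposite i)
  b = toℕ (opposite j)
  c = toℕ i
  e = toℕ j
  sum≡d*k : toℕ (combine (opposite i) (opposite j)) ℕ.+ suc (toℕ (combine i j)) ≡ d * k
  sum≡d*k = begin
    toℕ (combine (opposite i) (opposite j)) ℕ.+ suc (toℕ (combine i j))
      ≡⟨ cong₂ (λ x y → x ℕ.+ suc y) (Fin.toℕ-combine (opposite i) (opposite j)) (Fin.toℕ-combine i j) ⟩
    (k * a ℕ.+ b) ℕ.+ suc (k * c ℕ.+ e) ≡⟨ regroup k a b c e ⟩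
    k * (a ℕ.+ c) ℕ.+ (b ℕ.+ suc e)     ≡⟨ cong (k * (a ℕ.+ c) ℕ.+_) (toℕ-opposite-+-suc j) ⟩
    k * (a ℕ.+ c) ℕ.+ k                 ≡⟨ collect k a c ⟩
    k * (a ℕ.+ suc c)                   ≡⟨ cong (k *_) (toℕ-opposite-+-suc i) ⟩
    k * d                               ≡⟨ ℕ.*-comm k d ⟩
    d * k                               ∎
    where
    regroup : ∀ k a b c e → (k * a ℕ.+ b) ℕ.+ suc (k * c ℕ.+ e) ≡ k * (a ℕ.+ c) ℕ.+ (b ℕ.+ suc e)
    regroup = ℕ-Solver.solve-∀
    collect : ∀ k a c → k * (a ℕ.+ c) ℕ.+ k ≡ k * (a ℕ.+ suc c)
    collect = ℕ-Solver.solve-∀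

sumFin-cong : ∀ k {f g : Fin k → ℤ} → (∀ i → f i ≡ g i) → sumFin k f ≡ sumFin k g
sumFin-cong ℕ.zero    f≡g = refl
sumFin-cong (suc k) f≡g = cong₂ _+_ (f≡g zero) (sumFin-cong k (λ i → f≡g (suc i)))

sumFin-+ : ∀ k (f g : Fin k → ℤ) → sumFin k (λ i → f i + g i) ≡ sumFin k f + sumFin k g
sumFin-+ ℕ.zero    f g = refl
sumFin-+ (suc k) f g =
  trans (cong (_+_ (f zero + g zero)) (sumFin-+ k (λ i → f (suc i)) (λ i → g (suc i))))
        (interchange (f zero) (g zero) _ _)

sumFin-0 : ∀ k → sumFin k (λ _ → 0ℤ) ≡ 0ℤ
sumFin-0 ℕ.zero    = refl
sumFin-0 (suc k) = trans (ℤ.+-identityˡ _) (sumFin-0 k)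

δ-suc : ∀ {k} (i j : Fin k) → δ (suc i) (suc j) ≡ δ i j
δ-suc i j with i Fin.≟ j
... | yes _ = refl
... | no  _ = refl

sumFin-*δ : ∀ k (A : Fin k → ℤ) (s : Fin k) → sumFin k (λ r → A r ℤ.* δ r s) ≡ A s
sumFin-*δ (suc k) A zero =
  trans (cong₂ _+_ (ℤ.*-identityʳ (A zero)) rest≡0) (ℤ.+-identityʳ (A zero))
  where
  rest≡0 : sumFin k (λ i → A (suc i) ℤ.* 0ℤ) ≡ 0ℤ
  rest≡0 = trans (sumFin-cong k (λ i → ℤ.*-zeroʳ (A (suc i)))) (sumFin-0 k)
sumFin-*δ (suc k) A (suc s) =
  trans (cong₂ _+_ (ℤ.*-zeroʳ (A zero)) rest≡A) (ℤ.+-identityˡ (A (suc s)))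
  where
  rest≡A : sumFin k (λ i → A (suc i) ℤ.* δ (suc i) (suc s)) ≡ A (suc s)
  rest≡A = trans (sumFin-cong k (λ i → cong (A (suc i) ℤ.*_) (δ-suc i s))) (sumFin-*δ k (λ i → A (suc i)) s)

·ᵥₘ-X : ∀ {k} (A : Fin k → ℤ) (s : Fin k) → (A ·ᵥₘ X k) s ≡ A s + A (opposite s)
·ᵥₘ-X {k} A s = begin
  sumFin k (λ r → A r ℤ.* (δ r s + δ r (opposite s)))
    ≡⟨ sumFin-cong k (λ r → ℤ.*-distribˡ-+ (A r) (δ r s) (δ r (opposite s))) ⟩
  sumFin k (λ r → A r ℤ.* δ r s + A r ℤ.* δ r (opposite s))
    ≡⟨ sumFin-+ k _ _ ⟩
  sumFin k (λ r → A r ℤ.* δ r s) + sumFin k (λ r → A r ℤ.* δ r (opposite s))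
    ≡⟨ cong₂ _+_ (sumFin-*δ k A s) (sumFin-*δ k A (opposite s)) ⟩
  A s + A (opposite s) ∎
  where open ≡-Reasoning

module _ (k : ℕ) .{{_ : NonZero k}} (A D : Fin k → ℤ) where

  private
    u : ℤ → ℤ
    u = IAP k A D

  IAP-r+q*k : ∀ (r : Fin k) q → u (+ (toℕ r ℕ.+ q * k)) ≡ A r + + q ℤ.* D r
  IAP-r+q*k r q = cong₂ (λ i q → A i + + q ℤ.* D i) remainder quotient
    where
    open ≡-Reasoning
    n : ℕ
    n = toℕ r ℕ.+ q * k
    r<k : toℕ r ℕ.< k
    r<k = Fin.toℕ<n r
    remainder : fromℕ< (ℕ.m%n<n n k) ≡ r
    remainder = Fin.toℕ-injective (begin
      toℕ (fromℕ< (ℕ.m%n<n n k)) ≡⟨ Fin.toℕ-fromℕ< (ℕ.m%n<n n k) ⟩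
      n ℕ.% k                    ≡⟨ ℕ.[m+kn]%n≡m%n (toℕ r) q k ⟩
      toℕ r ℕ.% k                ≡⟨ ℕ.m<n⇒m%n≡m r<k ⟩
      toℕ r                      ∎)
    quotient : n ℕ./ k ≡ q
    quotient = begin
      n ℕ./ k                     ≡⟨ ℕ.+-distrib-/-∣ʳ (toℕ r) (ℕ.n∣m*n q) ⟩
      toℕ r ℕ./ k ℕ.+ q * k ℕ./ k ≡⟨ cong₂ ℕ._+_ (ℕ.m<n⇒m/n≡0 r<k) (ℕ.m*n/n≡m q k) ⟩
      q                           ∎

  firstPeriod-IAP-combine : ∀ {d} (i : Fin d) (r : Fin k) →
                            firstPeriod (d * k) u (combine i r) ≡ A r + + toℕ i ℤ.* D r
  firstPeriod-IAP-combine i r = trans (cong (λ n → u (+ n)) index) (IAP-r+q*k r (toℕ i))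
    where
    index : toℕ (combine i r) ≡ toℕ r ℕ.+ toℕ i * k
    index = trans (Fin.toℕ-combine i r)
                  (trans (ℕ.+-comm (k * toℕ i) (toℕ r)) (cong (toℕ r ℕ.+_) (ℕ.*-comm k (toℕ i))))

  firstPeriod-IAP-opposite-combine :
    ∀ {d} (i : Fin d) (r : Fin k) →
    firstPeriod (d * k) u (opposite (combine i r)) ≡ A (opposite r) + + toℕ (opposite i) ℤ.* D (opposite r)
  firstPeriod-IAP-opposite-combine i r =
    trans (cong (firstPeriod _ u) (opposite-combine i r)) (firstPeriod-IAP-combine (opposite i) (opposite r))

  module _ (m : ℕ) where
    open Congruence m
    open import Relation.Binary.Reasoning.Setoid setoid

    periodic⇒d*D≈0 : ∀ d → Periodic m (d * k) u → ∀ r → + d ℤ.* D r ≈ 0ℤ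
    periodic⇒d*D≈0 d periodic r = +-cancelˡ (A r) (begin
      A r + + d ℤ.* D r       ≡⟨ IAP-r+q*k r d ⟨
      u (+ toℕ r + + (d * k)) ≈⟨ ≡[mod]⇒≈ (periodic (+ toℕ r)) ⟩
      u (+ toℕ r)             ≡⟨ cong (λ n → u (+ n)) (sym (ℕ.+-identityʳ (toℕ r))) ⟩
      u (+ (toℕ r ℕ.+ 0 * k)) ≡⟨ IAP-r+q*k r 0 ⟩
      A r + 0ℤ                ∎)

    antisymmetric⇒D≋AX : ∀ d .{{_ : NonZero d}} → (∀ r → + d ℤ.* D r ≈ 0ℤ) →
                         Antisymmetric m (d * k) (firstPeriod (d * k) u) →
                         D ≋[mod m ] (A ·ᵥₘ X k)
    antisymmetric⇒D≋AX (suc d) d*D≈0 antisymmetric s = ≈⇒≡[mod] (begin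
      D s                                               ≡⟨ identity (A s) (+ d) (D s) ⟩
      (A s + - (A s + + d ℤ.* D s)) + + suc d ℤ.* D s   ≈⟨ +-cong (+-congˡ (A s) (≈-sym A-opposite))
                                                                  (d*D≈0 s) ⟩
      (A s + A (opposite s)) + 0ℤ                       ≡⟨ ℤ.+-identityʳ _ ⟩
      A s + A (opposite s)                              ≡⟨ ·ᵥₘ-X A s ⟨
      (A ·ᵥₘ X k) s                                     ∎)
      where
      identity : ∀ a x y → y ≡ (a + - (a + x ℤ.* y)) + (+ 1 + x) ℤ.* y
      identity = solve-∀
      last : Fin (suc d)
      last = opposite zero
      A-opposite : A (opposite s) ≈ - (A s + + d ℤ.* D s)
      A-opposite = begin
        A (opposite s)
          ≡⟨ ℤ.+-identityʳ (A (opposite s)) ⟨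
        A (opposite s) + + 0 ℤ.* D (opposite s)
          ≡⟨ cong (λ i → A (opposite s) + + toℕ i ℤ.* D (opposite s)) (Fin.opposite-involutive {suc d} zero) ⟨
        A (opposite s) + + toℕ (opposite last) ℤ.* D (opposite s)
          ≡⟨ firstPeriod-IAP-opposite-combine last s ⟨
        firstPeriod _ u (opposite (combine last s))
          ≈⟨ ≡[mod]⇒≈ (antisymmetric (combine last s)) ⟩
        - firstPeriod _ u (combine last s)
          ≡⟨ cong -_ (firstPeriod-IAP-combine last s) ⟩
        - (A s + + toℕ last ℤ.* D s)
          ≡⟨ cong (λ n → - (A s + + n ℤ.* D s)) (Fin.toℕ-fromℕ d) ⟩
        - (A s + + d ℤ.* D s)
          ∎

    D≋AX⇒antisymmetric : ∀ d → (∀ r → + d ℤ.* D r ≈ 0ℤ) → D ≋[mod m ] (A ·ᵥₘ X k) →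
                         Antisymmetric m (d * k) (firstPeriod (d * k) u)
    D≋AX⇒antisymmetric d d*D≈0 D≋AX j with i , r , refl ← Fin.combine-surjective {d} j =
      ≈⇒≡[mod] (x+y≈0⇒x≈-y (v (opposite (combine i r))) (v (combine i r)) (begin
        v (opposite (combine i r)) + v (combine i r)
          ≡⟨ cong₂ _+_ (firstPeriod-IAP-opposite-combine i r) (firstPeriod-IAP-combine i r) ⟩
        (A r′ + + c ℤ.* D r′) + (A r + + e ℤ.* D r)
          ≈⟨ +-congʳ (A r + + e ℤ.* D r) (+-congˡ (A r′) (*-congˡ (+ c) D-opposite)) ⟩
        (A r′ + + c ℤ.* D r) + (A r + + e ℤ.* D r)
          ≡⟨ regroup (A r) (A r′) (+ c) (+ e) (D r) ⟩
        (A r + A r′) + (+ c + + e) ℤ.* D r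
          ≈⟨ +-congʳ ((+ c + + e) ℤ.* D r) (≈-sym (D≈A+A′ r)) ⟩
        D r + (+ c + + e) ℤ.* D r
          ≡⟨ collect (+ c) (+ e) (D r) ⟩
        + (c ℕ.+ suc e) ℤ.* D r
          ≡⟨ cong (λ n → + n ℤ.* D r) (toℕ-opposite-+-suc i) ⟩
        + d ℤ.* D r
          ≈⟨ d*D≈0 r ⟩
        0ℤ
          ∎))
      where
      v : Fin (d * k) → ℤ
      v = firstPeriod (d * k) u
      r′ : Fin k
      r′ = opposite r
      c e : ℕ
      c = toℕ (opposite i)
      e = toℕ i
      regroup : ∀ a a′ x y z → (a′ + x ℤ.* z) + (a + y ℤ.* z) ≡ (a + a′) + (x + y) ℤ.* z
      regroup = solve-∀
      collect : ∀ x y z → z + (x + y) ℤ.* z ≡ (x + (+ 1 + y)) ℤ.* z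
      collect = solve-∀
      D≈A+A′ : ∀ s → D s ≈ A s + A (opposite s)
      D≈A+A′ s = ≈-trans (≡[mod]⇒≈ (D≋AX s)) (≈-reflexive (·ᵥₘ-X A s))
      D-opposite : D r′ ≈ D r
      D-opposite = begin
        D r′                   ≈⟨ D≈A+A′ r′ ⟩
        A r′ + A (opposite r′) ≡⟨ cong (λ s → A r′ + A s) (Fin.opposite-involutive r) ⟩
        A r′ + A r             ≡⟨ ℤ.+-comm (A r′) (A r) ⟩
        A r + A r′             ≈⟨ D≈A+A′ r ⟨
        D r                    ∎

proposition12 : (m : ℕ) .{{_ : NonZero m}} (k d : ℕ) .{{_ : NonZero k}} .{{_ : NonZero d}}
                (A D : Fin k → ℤ) →
                Periodic m (d * k) (IAP k A D) →
                (Antisymmetric m (d * k) (firstPeriod (d * k) (IAP k A D)) ⇔ (D ≋[mod m ] (A ·ᵥₘ X k)))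
proposition12 m k d A D periodic =
  mk⇔ (antisymmetric⇒D≋AX k A D m d d*D≈0) (D≋AX⇒antisymmetric k A D m d d*D≈0)
  where
  d*D≈0 : ∀ r → Congruence._≈_ m (+ d ℤ.* D r) 0ℤ
  d*D≈0 = periodic⇒d*D≈0 k A D m d periodic
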